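{- Let $S$ be a $^+1$-monoid and $S'=\{s-1:s\in S\}$. Then for every integer $\ell\in S'$ and every sequence $s_1,\dots,s_\ell$ of elements of $S$, the sum $\sum_{j=1}^\ell s_j$ lies in $S'$.
   Context: A set $S\subseteq\mathbb{Z}^+$ is a $^+1$-monoid if (1) $1\in S$, and (2) for every $\ell\in S$ and every sequence $s_1,\dots,s_\ell$ of elements of $S$, the sum $\sum_{j=1}^\ell s_j$ lies in $S$. -}

module Defs where

open import Data.Nat using (ℕ; zero; suc; _+_; _∸_; _≥_)
open import Data.Fin using (Fin; zero; suc)
open import Data.Product using (Σ; _×_)
open import Relation.Binary.PropositionalEquality using (_≡_)

-- Σⱼ s j for j = 0 .. ℓ-1 (i.e. s_1 + ... + s_ℓ, 0-indexed)
finSum : (ℓ : ℕ) → (Fin ℓ → ℕ) → ℕ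
finSum zero    s = 0
finSum (suc ℓ) s = s zero + finSum ℓ (λ j → s (suc j))

-- A set S ⊆ ℤ⁺ is represented by a predicate on ℕ whose members are all ≥ 1.
-- S is a ⁺1-monoid: 1 ∈ S and for ℓ ∈ S and s₁..s_ℓ ∈ S, Σ sⱼ ∈ S.
record IsPlus1Monoid (S : ℕ → Set) : Set where
  field
    positive : ∀ n → S n → n ≥ 1
    one∈S    : S 1
    closed   : ∀ ℓ → S ℓ → (s : Fin ℓ → ℕ) → (∀ j → S (s j)) → S (finSum ℓ s)

Shift : (ℕ → Set) → ℕ → Set
Shift S n = Σ ℕ (λ s → S s × n ≡ s ∸ 1)

module Submission where

-- If ℓ ∈ S' then ℓ = t - 1 for some t ∈ S, and since elements
-- of S are positive, t = ℓ + 1.  Prepend the element 1 ∈ S to the sequence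
-- s₁, …, s_ℓ: this gives ℓ + 1 terms of S, so by the ⁺1-monoid closure law
-- their sum 1 + Σⱼ sⱼ lies in S, whence Σⱼ sⱼ = (1 + Σⱼ sⱼ) - 1 lies in S'.

open import Defs
open import Data.Nat using (ℕ; zero; suc; _+_; _≥_)
open import Data.Fin using (Fin; zero; suc)
open import Data.Product using (_,_)
open import Relation.Binary.PropositionalEquality using (_≡_; refl; subst)

shift-elim : (S : ℕ → Set) → (∀ n → S n → n ≥ 1) →
             ∀ {n} → Shift S n → S (suc n)
shift-elim S positive (suc t , St , refl) = St
shift-elim S positive (zero  , S0 , refl) with positive zero S0
... | ()

shift-intro : (S : ℕ → Set) → ∀ {n} → S (suc n) → Shift S n
shift-intro S {n} Sn+1 = suc n , Sn+1 , refl

cons : ∀ {ℓ} → ℕ → (Fin ℓ → ℕ) → Fin (suc ℓ) → ℕ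
cons x s zero    = x
cons x s (suc j) = s j

cons-all : (P : ℕ → Set) → ∀ {ℓ x} {s : Fin ℓ → ℕ} →
           P x → (∀ j → P (s j)) → ∀ j → P (cons x s j)
cons-all P Px Ps zero    = Px
cons-all P Px Ps (suc j) = Ps j

finSum-cons : ∀ ℓ x (s : Fin ℓ → ℕ) → finSum (suc ℓ) (cons x s) ≡ x + finSum ℓ s
finSum-cons ℓ x s = refl

proposition5p3 : (S : ℕ → Set) → IsPlus1Monoid S →
    ∀ ℓ → Shift S ℓ → (s : Fin ℓ → ℕ) → (∀ j → S (s j)) → Shift S (finSum ℓ s)
proposition5p3 S M ℓ ℓ∈S' s s∈S = shift-intro S 1+Σs∈S
  where
  open IsPlus1Monoid M
  1+Σs∈S : S (suc (finSum ℓ s))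
  1+Σs∈S = subst S (finSum-cons ℓ 1 s)
             (closed (suc ℓ) (shift-elim S positive ℓ∈S') (cons 1 s)
                     (cons-all S one∈S s∈S))
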